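{- Let $\Lambda=(B,K,\Theta)$ be a signature with parameter set $A$, let $(X,p)$ be a regular $\natural$-invariant bottomed $\Lambda$-algebra, and let $U$ be an $A$-family of sets with $U_a\subseteq X_a\setminus\{\bot_a\}$ for all $a\in A$. Let $(Y,q)$ be the unique $U$-minimal subalgebra of the underlying (ordinary) $\Lambda$-algebra of $(X,p)$. Then $(Y,q)$ is $U$-initial and $\bot_b\notin Y_b$ for each $b\in B$.
   Context: A signature is a triple $\Lambda=(B,K,\Theta)$ with $B,K$ non-empty sets and $\Theta$ assigning to each $k\in K$ a pair $(\underline{k},\overline{k})$, $\overline{k}\in B$, $\underline{k}:D_k\to B$ with $D_k$ finite. $K_b=\{k:\overline{k}=b\}$; parameter set $A=\{b:K_b=\emptyset\}$. For a $B$-family of sets $X$ and $\gamma:I\to B$ ($I$ finite), $[X]_\gamma$ is the set of maps $v$ on $I$ with $v(\eta)\in X_{\gamma(\eta)}$; for maps $\pi_b:X_b\to Y_b$, $[\pi]_\gamma(v)(\eta)=\pi_{\gamma(\eta)}(v(\eta))$. A $\Lambda$-algebra is a pair $(X,p)$ with $X$ a $B$-family of sets and maps $p_k:[X]_{\underline{k}}\to X_{\overline{k}}$; a homomorphism $\pi:(X,p)\to(Y,q)$ is a family of maps $\pi_b:X_b\to Y_b$ with $q_k\circ[\pi]_{\underline{k}}=\pi_{\overline{k}}\circ p_k$. A family $Z\subseteq X$ is invariant if $p_k([Z]_{\underline{k}})\subseteq Z_{\overline{k}}$ for all $k$; an invariant family $Z$ gives the subalgebra $(Z,p|)$ with the restricted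 maps. For an $A$-family of sets $U$, a $\Lambda$-algebra $(Y,q)$ is bound to $U$ if $Y_a=U_a$ for $a\in A$; it is $U$-minimal if it is bound to $U$ and $Y$ is its only invariant family $Z$ with $Z_a=U_a$ for all $a\in A$; it is $U$-initial if it is bound to $U$ and for each $\Lambda$-algebra $(Y',q')$ bound to $U$ there is exactly one homomorphism $(Y,q)\to(Y',q')$ which is the identity on each $Y_a$, $a\in A$. For any $\Lambda$-algebra $(X,p)$ and $A$-family $U$ with $U_a\subseteq X_a$, there is a unique subalgebra of $(X,p)$ that is $U$-minimal. A bottomed set is a set with a distinguished element $\bot$; a bottomed $\Lambda$-algebra is a $\Lambda$-algebra $(X,p)$ in which each $X_b$ is bottomed with bottom $\bot_b$ (no condition on the $p_k$); its underlying $\Lambda$-algebra forgets the bottoms. It is regular if for each $b\in B\setminus A$ and each $x\in X_b\setminus\{\bot_b\}$ there exist a unique $k\in K_b$ and a unique $v\in[X]_{\underline{k}}$ with $p_k(v)=x$. It is $\natural$-invariant if the family $(X_b\setminus\{\bot_b\})_{b\in B}$ is invariant, i.e. $p_k(v)\ne\bot_{\overline{k}}$ whenever $v(\eta)\ne\bot_{\underline{k}(\eta)}$ for all $\eta\in D_k$. -}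

module Defs where

open import Data.Nat using (ℕ; zero; suc)
open import Data.Unit using (⊤; tt)
open import Data.Fin using (Fin; zero; suc)
open import Data.Product using (Σ; _,_; proj₁; proj₂; _×_)
open import Data.Empty using (⊥)
open import Relation.Nullary using (¬_)
open import Relation.Binary.PropositionalEquality using (_≡_; _≢_; subst; refl)
open import Function using (_⇔_)

-- A signature Λ = (B, K, Θ).  The finite domain D_k is represented as Fin (ar k);
-- dom k = underline k, cod k = overline k.
record Signature : Set₁ where
  field
    B   : Set
    K   : Set
    b₀  : B
    k₀  : K
    ar  : K → ℕ
    dom : (k : K) → Fin (ar k) → B
    cod : K → B

module _ (Λ : Signature) where
  open Signature Λ

  -- b ∈ A  iff  K_b = ∅
  IsParam : B → Set
  IsParam b = ¬ (Σ K λ k → cod k ≡ b)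

  -- [X]_γ for γ : Fin n → B, as an explicit finite tuple
  -- (so that equality of tuples is componentwise, without function extensionality)
  Maps : (X : B → Set) {n : ℕ} → (Fin n → B) → Set
  Maps X {zero}  γ = ⊤
  Maps X {suc n} γ = X (γ zero) × Maps X (λ η → γ (suc η))

  at : {X : B → Set} {n : ℕ} {γ : Fin n → B} → Maps X γ → (η : Fin n) → X (γ η)
  at {n = suc n} (x , v) zero    = x
  at {n = suc n} (x , v) (suc η) = at v η

  mapMaps : {X Y : B → Set} (π : (b : B) → X b → Y b) {n : ℕ} {γ : Fin n → B} →
    Maps X γ → Maps Y γ
  mapMaps π {zero}  v       = tt
  mapMaps π {suc n} (x , v) = π _ x , mapMaps π v

  at-fst : {X : B → Set} {Z : (b : B) → X b → Set} {n : ℕ} {γ : Fin n → B}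
    (v : Maps (λ b → Σ (X b) (Z b)) γ) (η : Fin n) →
    proj₁ (at v η) ≡ at (mapMaps (λ _ → proj₁) v) η
  at-fst {n = suc n} (x , v) zero    = refl
  at-fst {n = suc n} (x , v) (suc η) = at-fst v η

  record Algebra : Set₁ where
    field
      carrier : B → Set
      op      : (k : K) → Maps carrier (dom k) → carrier (cod k)

  open Algebra

  IsHom : (𝒳 𝒴 : Algebra) → ((b : B) → carrier 𝒳 b → carrier 𝒴 b) → Set
  IsHom 𝒳 𝒴 π = (k : K) (v : Maps (carrier 𝒳) (dom k)) →
    op 𝒴 k (mapMaps π v) ≡ π (cod k) (op 𝒳 k v)

  Invariant : (𝒳 : Algebra) → ((b : B) → carrier 𝒳 b → Set) → Set
  Invariant 𝒳 Z = (k : K) (v : Maps (carrier 𝒳) (dom k)) →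
    ((η : Fin (ar k)) → Z (dom k η) (at v η)) → Z (cod k) (op 𝒳 k v)

  Sub : (𝒳 : Algebra) (Z : (b : B) → carrier 𝒳 b → Set) → Invariant 𝒳 Z → Algebra
  carrier (Sub 𝒳 Z inv) b = Σ (carrier 𝒳 b) (Z b)
  op (Sub 𝒳 Z inv) k v =
    op 𝒳 k (mapMaps (λ _ → proj₁) v) , inv k _ (λ η → subst (Z (dom k η)) (at-fst v η) (proj₂ (at v η)))

  -- predicate is proposition-valued (i.e. it really describes a subset)
  IsSubset : {X : B → Set} → ((b : B) → X b → Set) → Set
  IsSubset {X} Z = (b : B) (x : X b) (z z' : Z b x) → z ≡ z'

  record BottomedAlgebra : Set₁ where
    field
      alg : Algebra
      bot : (b : B) → carrier alg b

  module _ (𝔛 : BottomedAlgebra) where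
    open BottomedAlgebra 𝔛
    private
      X = carrier alg
      p = op alg

    record Preimage (b : B) (x : X b) : Set where
      constructor preimage
      field
        k   : K
        e   : cod k ≡ b
        v   : Maps X (dom k)
        hit : subst X e (p k v) ≡ x

    data SamePreimage {b : B} {x : X b} : Preimage b x → Preimage b x → Set where
      same : (k : K) (e e' : cod k ≡ b) (v v' : Maps X (dom k))
             (h : subst X e (p k v) ≡ x) (h' : subst X e' (p k v') ≡ x) →
             v ≡ v' →
             SamePreimage (preimage k e v h) (preimage k e' v' h')

    Regular : Set
    Regular = (b : B) → ¬ IsParam b → (x : X b) → x ≢ bot b →
      Σ (Preimage b x) λ r → (r' : Preimage b x) → SamePreimage r r'

    ♮-Invariant : Set
    ♮-Invariant = (k : K) (v : Maps X (dom k)) →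
      ((η : Fin (ar k)) → at v η ≢ bot (dom k η)) → p k v ≢ bot (cod k)

-- The minimal subalgebra Y is inductively generated from U, so every property preserved by the
-- operations and true on U holds on all of Y.  Applied to "is not ⊥" together with
-- ♮-invariance this shows that Y avoids the bottoms.  Consequently every element of Y of a
-- non-parameter sort is a non-bottom element of X, so by regularity it is p_k(v) for a unique
-- k and v; that is, the operations of Y are jointly injective.  For a minimal algebra with
-- jointly injective operations, the graph of the would-be homomorphism into any algebra bound
-- to U, defined inductively, is functional (by induction on derivations, using injectivity)
-- and total (by minimality), and every homomorphism extending the identity on U has its
-- graph inside it; this gives existence and uniqueness.
module Submission where

open import Defs
open import Data.Product using (Σ; _,_; proj₁; proj₂; _×_)
open import Data.Product.Properties.WithK using (,-injectiveʳ)
open import Data.Empty using (⊥-elim)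
open import Data.Nat using (ℕ; zero; suc)
open import Data.Fin using (Fin; zero; suc)
open import Data.Unit using (tt)
open import Relation.Nullary using (¬_)
open import Relation.Binary.PropositionalEquality using (_≡_; _≢_; refl; sym; trans; cong; cong₂; subst)
open import Relation.Binary.PropositionalEquality.Properties using (subst-subst-sym)
open import Function using (_⇔_; id; Equivalence)

subst-id-≡⇒≡-subst-sym : {A B : Set} (e : A ≡ B) {a : A} {b : B} →
  subst id e a ≡ b → a ≡ subst id (sym e) b
subst-id-≡⇒≡-subst-sym refl eq = eq

module _ (Λ : Signature) where
  open Signature Λ
  open Algebra

  at-mapMaps : {P Q : B → Set} (f : (b : B) → P b → Q b) {n : ℕ} {γ : Fin n → B}
    (v : Maps Λ P γ) (η : Fin n) → at Λ (mapMaps Λ f v) η ≡ f (γ η) (at Λ v η)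
  at-mapMaps f {suc n} (x , v) zero    = refl
  at-mapMaps f {suc n} (x , v) (suc η) = at-mapMaps f v η

  tabulate : {P : B → Set} {n : ℕ} {γ : Fin n → B} → ((η : Fin n) → P (γ η)) → Maps Λ P γ
  tabulate {n = zero}  f = tt
  tabulate {n = suc n} f = f zero , tabulate (λ η → f (suc η))

  at-tabulate : {P : B → Set} {n : ℕ} {γ : Fin n → B} (f : (η : Fin n) → P (γ η)) (η : Fin n) →
    at Λ {P} (tabulate {P} f) η ≡ f η
  at-tabulate {n = suc n} f zero    = refl
  at-tabulate {n = suc n} f (suc η) = at-tabulate (λ η → f (suc η)) η

  at-injective : {P : B → Set} {n : ℕ} {γ : Fin n → B} (v w : Maps Λ P γ) →
    ((η : Fin n) → at Λ v η ≡ at Λ w η) → v ≡ w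
  at-injective {n = zero}  tt      tt      eq = refl
  at-injective {n = suc n} (x , v) (y , w) eq =
    cong₂ _,_ (eq zero) (at-injective v w (λ η → eq (suc η)))

  -- U-minimality of an algebra, phrased as the induction principle it amounts to.
  IsMinimal : Algebra Λ → Set₁
  IsMinimal 𝒮 = (W : (b : B) → carrier 𝒮 b → Set) → Invariant Λ 𝒮 W →
    ((a : B) → IsParam Λ a → (y : carrier 𝒮 a) → W a y) →
    (b : B) (y : carrier 𝒮 b) → W b y

  Application : Algebra Λ → Set
  Application 𝒳 = Σ K λ k → Maps Λ (carrier 𝒳) (dom k)

  OpsInjective : Algebra Λ → Set
  OpsInjective 𝒳 = {k k' : K} (v : Maps Λ (carrier 𝒳) (dom k)) (v' : Maps Λ (carrier 𝒳) (dom k'))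
    (e : cod k' ≡ cod k) → subst (carrier 𝒳) e (op 𝒳 k' v') ≡ op 𝒳 k v →
    _≡_ {A = Application 𝒳} (k' , v') (k , v)

  module SubalgebraOfSubset (𝒳 : Algebra Λ) (Z : (b : B) → carrier 𝒳 b → Set)
      (inv : Invariant Λ 𝒳 Z) (Z-subset : IsSubset Λ Z) where
    private
      X = carrier 𝒳
      Y = carrier (Sub Λ 𝒳 Z inv)

    proj₁-injective : {b : B} (s t : Y b) → proj₁ s ≡ proj₁ t → s ≡ t
    proj₁-injective {b} (x , z) (.x , z') refl = cong (x ,_) (Z-subset b x z z')

    mapMaps-proj₁-injective : {n : ℕ} {γ : Fin n → B} (v w : Maps Λ Y γ) →
      mapMaps Λ (λ _ → proj₁) v ≡ mapMaps Λ (λ _ → proj₁) w → v ≡ w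
    mapMaps-proj₁-injective {zero}  tt      tt      eq = refl
    mapMaps-proj₁-injective {suc n} (s , v) (t , w) eq =
      cong₂ _,_ (proj₁-injective s t (cong proj₁ eq)) (mapMaps-proj₁-injective v w (cong proj₂ eq))

    proj₁-subst : {b b' : B} (e : b ≡ b') (s : Y b) → proj₁ (subst Y e s) ≡ subst X e (proj₁ s)
    proj₁-subst refl s = refl

    application-proj₁-injective : {k k' : K} (v : Maps Λ Y (dom k)) (v' : Maps Λ Y (dom k')) →
      _≡_ {A = Application 𝒳} (k' , mapMaps Λ (λ _ → proj₁) v') (k , mapMaps Λ (λ _ → proj₁) v) →
      _≡_ {A = Application (Sub Λ 𝒳 Z inv)} (k' , v') (k , v)
    application-proj₁-injective {k} {k'} v v' eq with cong proj₁ eq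
    ... | refl = cong (k ,_) (mapMaps-proj₁-injective v' v (,-injectiveʳ eq))

    Sub-opsInjective :
      ({k k' : K} (v : Maps Λ X (dom k)) (v' : Maps Λ X (dom k')) (e : cod k' ≡ cod k) →
        Z (cod k) (op 𝒳 k v) → subst X e (op 𝒳 k' v') ≡ op 𝒳 k v →
        _≡_ {A = Application 𝒳} (k' , v') (k , v)) →
      OpsInjective (Sub Λ 𝒳 Z inv)
    Sub-opsInjective injective v v' e eq =
      application-proj₁-injective v v'
        (injective _ _ e (proj₂ (op (Sub Λ 𝒳 Z inv) _ v))
          (trans (sym (proj₁-subst e (op (Sub Λ 𝒳 Z inv) _ v'))) (cong proj₁ eq)))

  module _ (𝔛 : BottomedAlgebra Λ) where
    open BottomedAlgebra 𝔛
    private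
      X = carrier alg

    SamePreimage⇒≡-application : {b : B} {x : X b} {r r' : Preimage Λ 𝔛 b x} →
      SamePreimage Λ 𝔛 r r' →
      _≡_ {A = Application alg} (Preimage.k r , Preimage.v r) (Preimage.k r' , Preimage.v r')
    SamePreimage⇒≡-application (same k e e' v v' h h' refl) = refl

    regular⇒opsInjective-off-⊥ : Regular Λ 𝔛 →
      {k k' : K} (v : Maps Λ X (dom k)) (v' : Maps Λ X (dom k')) (e : cod k' ≡ cod k) →
      op alg k v ≢ bot (cod k) → subst X e (op alg k' v') ≡ op alg k v →
      _≡_ {A = Application alg} (k' , v') (k , v)
    regular⇒opsInjective-off-⊥ regular {k} {k'} v v' e x≢⊥ eq =
      trans (sym (SamePreimage⇒≡-application (unique (preimage k' e v' eq))))
            (SamePreimage⇒≡-application (unique (preimage k refl v refl)))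
      where
      unique = proj₂ (regular (cod k) (λ param → param (k , refl)) (op alg k v) x≢⊥)

    minimal-avoids-⊥ : ♮-Invariant Λ 𝔛 →
      (Z : (b : B) → X b → Set) (inv : Invariant Λ alg Z) → IsMinimal (Sub Λ alg Z inv) →
      ((a : B) → IsParam Λ a → (x : X a) → Z a x → x ≢ bot a) →
      (b : B) (y : carrier (Sub Λ alg Z inv) b) → proj₁ y ≢ bot b
    minimal-avoids-⊥ ♮-inv Z inv minimal params-avoid-⊥ =
      minimal (λ b y → proj₁ y ≢ bot b)
        (λ k v args≢⊥ → ♮-inv k _ λ η → subst (_≢ bot (dom k η)) (at-fst Λ v η) (args≢⊥ η))
        (λ { a param (x , z) → params-avoid-⊥ a param x z })

  module Recursion (𝒮 : Algebra Λ) (minimal : IsMinimal 𝒮) (injective : OpsInjective 𝒮)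
      (𝒴 : Algebra Λ) (base : (a : B) → IsParam Λ a → carrier 𝒮 a → carrier 𝒴 a)
      (base-irrelevant : (a : B) (param param' : IsParam Λ a) (y : carrier 𝒮 a) →
        base a param y ≡ base a param' y) where
    private
      S = carrier 𝒮
      C = carrier 𝒴

    -- The recursion is not structural on 𝒮, so the homomorphism is first defined by its graph.
    data Graph : (b : B) → S b → C b → Set where
      base-graph : {a : B} {y : S a} (param : IsParam Λ a) → Graph a y (base a param y)
      op-graph : {b : B} {y : S b} {c : C b} (k : K) (e : cod k ≡ b)
        (v : Maps Λ S (dom k)) (w : Maps Λ C (dom k)) →
        ((η : Fin (ar k)) → Graph (dom k η) (at Λ v η) (at Λ w η)) →
        subst S e (op 𝒮 k v) ≡ y → subst C e (op 𝒴 k w) ≡ c → Graph b y c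

    Graph-functional : {b : B} {y : S b} {c c' : C b} → Graph b y c → Graph b y c' → c ≡ c'
    Graph-functional (base-graph param) (base-graph param') = base-irrelevant _ param param' _
    Graph-functional (base-graph param) (op-graph k e _ _ _ _ _) = ⊥-elim (param (k , e))
    Graph-functional (op-graph k e _ _ _ _ _) (base-graph param) = ⊥-elim (param (k , e))
    Graph-functional (op-graph k refl v w args refl refl) (op-graph k' e' v' w' args' eq refl)
      with injective v v' e' eq
    ... | refl with e'
    ... | refl = cong (op 𝒴 k)
      (at-injective w w' λ η → Graph-functional (args η) (args' η))

    Graph-total : (b : B) (y : S b) → Σ (C b) (Graph b y)
    Graph-total = minimal (λ b y → Σ (C b) (Graph b y))
      (λ k v images → op 𝒴 k (tabulate (λ η → proj₁ (images η))) ,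
         op-graph k refl v _
           (λ η → subst (Graph _ _) (sym (at-tabulate (λ η → proj₁ (images η)) η)) (proj₂ (images η)))
           refl refl)
      (λ a param y → base a param y , base-graph param)

    rec : (b : B) → S b → C b
    rec b y = proj₁ (Graph-total b y)

    Graph-rec : (b : B) (y : S b) → Graph b y (rec b y)
    Graph-rec b y = proj₂ (Graph-total b y)

    Graph-of-hom : (h : (b : B) → S b → C b) → IsHom Λ 𝒮 𝒴 h →
      ((a : B) (param : IsParam Λ a) (y : S a) → h a y ≡ base a param y) →
      (b : B) (y : S b) → Graph b y (h b y)
    Graph-of-hom h hom extends = minimal (λ b y → Graph b y (h b y))
      (λ k v args → op-graph k refl v (mapMaps Λ h v)
         (λ η → subst (Graph _ _) (sym (at-mapMaps h v η)) (args η)) refl (hom k v))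
      (λ a param y → subst (Graph a y) (sym (extends a param y)) (base-graph param))

    rec-isHom : IsHom Λ 𝒮 𝒴 rec
    rec-isHom k v = Graph-functional
      (op-graph k refl v (mapMaps Λ rec v)
        (λ η → subst (Graph _ _) (sym (at-mapMaps rec v η)) (Graph-rec _ (at Λ v η))) refl refl)
      (Graph-rec (cod k) (op 𝒮 k v))

    rec-extends : (a : B) (param : IsParam Λ a) (y : S a) → rec a y ≡ base a param y
    rec-extends a param y = Graph-functional (Graph-rec a y) (base-graph param)

    rec-unique : (h : (b : B) → S b → C b) → IsHom Λ 𝒮 𝒴 h →
      ((a : B) (param : IsParam Λ a) (y : S a) → h a y ≡ base a param y) →
      (b : B) (y : S b) → rec b y ≡ h b y
    rec-unique h hom extends b y = Graph-functional (Graph-rec b y) (Graph-of-hom h hom extends b y)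

proposition3p2p1 : (Λ : Signature) (𝔛 : BottomedAlgebra Λ) →
    Regular Λ 𝔛 → ♮-Invariant Λ 𝔛 →
    (U : (b : Signature.B Λ) → Algebra.carrier (BottomedAlgebra.alg 𝔛) b → Set) →
    IsSubset Λ U →
    ((a : Signature.B Λ) → IsParam Λ a → (x : Algebra.carrier (BottomedAlgebra.alg 𝔛) a) →
      U a x → x ≢ BottomedAlgebra.bot 𝔛 a) →
    (Z : (b : Signature.B Λ) → Algebra.carrier (BottomedAlgebra.alg 𝔛) b → Set) →
    (inv : Invariant Λ (BottomedAlgebra.alg 𝔛) Z) →
    IsSubset Λ Z →
    (bound : (a : Signature.B Λ) → IsParam Λ a →
      (x : Algebra.carrier (BottomedAlgebra.alg 𝔛) a) → Z a x ⇔ U a x) →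
    ((W : (b : Signature.B Λ) → Algebra.carrier (Sub Λ (BottomedAlgebra.alg 𝔛) Z inv) b → Set) →
      Invariant Λ (Sub Λ (BottomedAlgebra.alg 𝔛) Z inv) W →
      ((a : Signature.B Λ) → IsParam Λ a → (y : Algebra.carrier (Sub Λ (BottomedAlgebra.alg 𝔛) Z inv) a) → W a y) →
      (b : Signature.B Λ) (y : Algebra.carrier (Sub Λ (BottomedAlgebra.alg 𝔛) Z inv) b) → W b y) →
    ((𝒴 : Algebra Λ) →
      (eq : (a : Signature.B Λ) → IsParam Λ a →
        Algebra.carrier 𝒴 a ≡ Σ (Algebra.carrier (BottomedAlgebra.alg 𝔛) a) (U a)) →
      Σ ((b : Signature.B Λ) → Algebra.carrier (Sub Λ (BottomedAlgebra.alg 𝔛) Z inv) b → Algebra.carrier 𝒴 b)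
        λ h → IsHom Λ (Sub Λ (BottomedAlgebra.alg 𝔛) Z inv) 𝒴 h
          × ((a : Signature.B Λ) (pa : IsParam Λ a) (x : Algebra.carrier (BottomedAlgebra.alg 𝔛) a) (z : Z a x) →
               subst id (eq a pa) (h a (x , z)) ≡ (x , Equivalence.to (bound a pa x) z))
          × ((h' : (b : Signature.B Λ) → Algebra.carrier (Sub Λ (BottomedAlgebra.alg 𝔛) Z inv) b → Algebra.carrier 𝒴 b) →
               IsHom Λ (Sub Λ (BottomedAlgebra.alg 𝔛) Z inv) 𝒴 h' →
               ((a : Signature.B Λ) (pa : IsParam Λ a) (x : Algebra.carrier (BottomedAlgebra.alg 𝔛) a) (z : Z a x) →
                 subst id (eq a pa) (h' a (x , z)) ≡ (x , Equivalence.to (bound a pa x) z)) →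
               (b : Signature.B Λ) (y : Algebra.carrier (Sub Λ (BottomedAlgebra.alg 𝔛) Z inv) b) → h b y ≡ h' b y))
    × ((b : Signature.B Λ) → ¬ Z b (BottomedAlgebra.bot 𝔛 b))
proposition3p2p1 Λ 𝔛 regular ♮-inv U U-subset U-avoids-⊥ Z inv Z-subset bound minimal =
  (λ 𝒴 eq → let open Initial 𝒴 eq in
      rec
    , rec-isHom
    , (λ a param x z → trans (cong (subst id (eq a param)) (rec-extends a param (x , z)))
                             (subst-subst-sym (eq a param)))
    , λ h hom extends → rec-unique h hom λ { a param (x , z) →
        subst-id-≡⇒≡-subst-sym (eq a param) (extends a param x z) })
  , λ b z → Y-avoids-⊥ b (bot b , z) refl
  where
  open Signature Λ
  open BottomedAlgebra 𝔛
  open SubalgebraOfSubset Λ alg Z inv Z-subset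
  Y = Algebra.carrier (Sub Λ alg Z inv)

  Y-avoids-⊥ : (b : B) (y : Y b) → proj₁ y ≢ bot b
  Y-avoids-⊥ = minimal-avoids-⊥ Λ 𝔛 ♮-inv Z inv minimal
    (λ a param x z → U-avoids-⊥ a param x (Equivalence.to (bound a param x) z))

  injective : OpsInjective Λ (Sub Λ alg Z inv)
  injective = Sub-opsInjective λ v v' e z →
    regular⇒opsInjective-off-⊥ Λ 𝔛 regular v v' e (Y-avoids-⊥ _ (_ , z))

  module Initial (𝒴 : Algebra Λ)
      (eq : (a : B) → IsParam Λ a → Algebra.carrier 𝒴 a ≡ Σ (Algebra.carrier alg a) (U a)) where
    base : (a : B) → IsParam Λ a → Y a → Algebra.carrier 𝒴 a
    base a param (x , z) = subst id (sym (eq a param)) (x , Equivalence.to (bound a param x) z)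

    base-irrelevant : (a : B) (param param' : IsParam Λ a) (y : Y a) → base a param y ≡ base a param' y
    base-irrelevant a param param' (x , z) =
      cong (λ u → subst id (sym (eq a param)) (x , u)) (U-subset a x _ _)

    open Recursion Λ (Sub Λ alg Z inv) minimal injective 𝒴 base base-irrelevant public
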